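{- Let $\Psi$ be a fan-in $2$ noncommutative arithmetic circuit of size $s$ computing $\mathrm{Pal}_{n,n}(X,Y)$, and let $\mathcal{B}_{d'}\subseteq\mathbb{F}\langle X\rangle$ be the set constructed from $\Psi$ as described in the context. Then $$\bigl|\{v\in \mathcal{B}_{d'} \mid \pi_n(v)\neq 0\}\bigr|\le (s+n+1)\sum_{r=0}^{n}\frac{s^r}{r!}.$$
   Context: Let $\mathbb{F}$ be a field, $X=\{x_1,\dots,x_n\}$, $Y=\{y_1,\dots,y_n\}$ disjoint sets of noncommuting variables, and $\mathrm{Pal}_{n,n}(X,Y)=\sum_{(i_1,\dots,i_n)\in[n]^n} x_{i_1}\cdots x_{i_n}\,y_{i_n}\cdots y_{i_1}$. A fan-in $2$ noncommutative arithmetic circuit is a DAG whose leaves are labeled by field constants or variables, whose internal nodes (gates) are labeled $+$ or $\times$, each of in-degree exactly $2$, with designated left/right children at $\times$ gates; edges may carry field-constant weights scaling the polynomial along the edge. Size is the number of vertices. For a gate $g$, $\widehat g$ denotes the polynomial it computes. The syntactic degree $d(g)$ is defined recursively: a leaf labeled by a variable has degree $1$, a leaf labeled by a constant has degree $0$, a $+$ gate has the maximum of its children's degrees, a $\times$ gate has the sum of its children's degrees. Construction: Let $l_1<l_2<\cdots<l_{d'}$ be the distinct syntactic degrees appearing in $\Psi$. For $k\in[d']$ let $P_k$ be the set of $\times$ gates $g$ with $d(g)=l_k$. For a gate $g$, let $\widehat g_X$ be the sum (with coefficients) of all non-constant monomials of $\widehat g$ involving only variables from $X$; so $\widehat g_X\in\mathbb{F}\langle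 X\rangle$. For $k\in[d']$ let $\mathcal{M}_k=\{\widehat a_X : \text{there is a }\times\text{ gate } g\in P_k \text{ whose left child is } a\}$. Define $\mathcal{B}_1=\{1,x_1,\dots,x_n\}$ and for $2\le k\le d'$, $$\mathcal{B}_k=\mathcal{B}_{k-1}\cup\{\widehat g_X\mid g\in P_k\}\cup\{p\,h\mid p\in\mathcal{M}_k,\ h\in\mathcal{B}_{k-1}\}.$$ Finally, $\pi_n:\mathbb{F}\langle X\rangle\to\mathbb{F}\langle X\rangle$ is the linear map sending a polynomial to its homogeneous degree-$n$ component (the sum of its terms of degree exactly $n$). -}

module Defs where

open import Level using (Level; _⊔_; Lift) renaming (suc to lsuc)
open import Algebra.Bundles using (CommutativeRing)
open import Data.Nat as ℕ using (ℕ; zero; suc; _∸_; _!; _^_)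
open import Data.Nat.Properties using (≤-decTotalOrder; _!≢0)
open import Data.Fin as Fin using (Fin; inject₁; fromℕ)
open import Data.Fin.Properties as FinP using ()
open import Data.Sum using (_⊎_; inj₁; inj₂)
open import Data.Sum.Properties using (≡-dec)
open import Data.Product using (Σ; ∃; _×_; _,_)
open import Data.List as List using (List; []; _∷_; _++_; length; deduplicate)
open import Data.List.Properties using (≡-dec)
open import Data.List.Sort ≤-decTotalOrder using (sort)
open import Data.Vec as Vec using (Vec; _∷ʳ_; lookup)
open import Data.Rational as ℚ using (ℚ)
open import Data.Integer using (+_)
open import Relation.Nullary using (¬_; yes; no; Dec)
open import Relation.Binary.PropositionalEquality using (_≡_)

record Field (c ℓ : Level) : Set (lsuc (c ⊔ ℓ)) where
  field
    commutativeRing : CommutativeRing c ℓ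
  open CommutativeRing commutativeRing public
  field
    0≉1     : ¬ (0# ≈ 1#)
    inverse : ∀ x → ¬ (x ≈ 0#) → Σ Carrier λ y → x * y ≈ 1#

sumUpTo : ℕ → (ℕ → ℚ) → ℚ
sumUpTo zero    f = f 0
sumUpTo (suc n) f = sumUpTo n f ℚ.+ f (suc n)

ℕtoℚ : ℕ → ℚ
ℕtoℚ k = (+ k) ℚ./ 1

palBound : (s n : ℕ) → ℚ
palBound s n =
  ℕtoℚ (s ℕ.+ n ℕ.+ 1) ℚ.* sumUpTo n (λ r → ((+ (s ^ r)) ℚ./ (r !)) {{r !≢0}})

module Circuits {c ℓ : Level} (F : Field c ℓ) (n : ℕ) where
  open Field F

  -- A (noncommutative) polynomial over an alphabet A is given by its
  -- coefficient function on words (monomials) over A; equality of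
  -- polynomials is coefficientwise equality.
  Poly : Set → Set c
  Poly A = List A → Carrier

  _≈ₚ_ : ∀ {A} → Poly A → Poly A → Set ℓ
  f ≈ₚ g = ∀ w → f w ≈ g w

  0ₚ : ∀ {A} → Poly A
  0ₚ _ = 0#

  1ₚ : ∀ {A} → Poly A
  1ₚ []      = 1#
  1ₚ (_ ∷ _) = 0#

  constₚ : ∀ {A} → Carrier → Poly A
  constₚ a []      = a
  constₚ a (_ ∷ _) = 0#

  monoₚ : ∀ {A} → ((a b : A) → Dec (a ≡ b)) → List A → Poly A
  monoₚ dec u w with Data.List.Properties.≡-dec dec u w
  ... | yes _ = 1#
  ... | no  _ = 0#

  _+ₚ_ : ∀ {A} → Poly A → Poly A → Poly A
  (f +ₚ g) w = f w + g w

  _·ₚ_ : ∀ {A} → Carrier → Poly A → Poly A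
  (a ·ₚ f) w = a * f w

  -- noncommutative product: (f g)(w) = Σ_{w = u v} f(u) g(v)
  _*ₚ_ : ∀ {A} → Poly A → Poly A → Poly A
  (f *ₚ g) []      = f [] * g []
  (f *ₚ g) (a ∷ w) = f [] * g (a ∷ w) + ((λ u → f (a ∷ u)) *ₚ g) w

  -- Variables: inj₁ i is x_i, inj₂ i is y_i.
  Var : Set
  Var = Fin n ⊎ Fin n

  decVar : (a b : Var) → Dec (a ≡ b)
  decVar = Data.Sum.Properties.≡-dec FinP._≟_ FinP._≟_

  PolyXY : Set c
  PolyXY = Poly Var

  PolyX : Set c
  PolyX = Poly (Fin n)

  xₚ : Fin n → PolyX
  xₚ i = monoₚ FinP._≟_ (i ∷ [])

  sumFin : ∀ {A} → (k : ℕ) → (Fin k → Poly A) → Poly A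
  sumFin zero    f = 0ₚ
  sumFin (suc k) f = f Fin.zero +ₚ sumFin k (λ i → f (Fin.suc i))

  sumTuples : ∀ {A} → (k : ℕ) → (Vec (Fin n) k → Poly A) → Poly A
  sumTuples zero    f = f Vec.[]
  sumTuples (suc k) f = sumFin n (λ i → sumTuples k (λ is → f (i Vec.∷ is)))

  palWord : ∀ {k} → Vec (Fin n) k → List Var
  palWord Vec.[]       = []
  palWord (i Vec.∷ is) = inj₁ i ∷ (palWord is List.++ (inj₂ i ∷ []))

  Pal : PolyXY
  Pal = sumTuples n (λ is → monoₚ decVar (palWord is))

  -- ĝ_X : sum of the non-constant monomials involving only X-variables
  restrictX : PolyXY → PolyX
  restrictX f []      = 0#
  restrictX f (a ∷ w) = f (List.map inj₁ (a ∷ w))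

  πₙ : PolyX → PolyX
  πₙ f w with length w ℕ.≟ n
  ... | yes _ = f w
  ... | no  _ = 0#

  -- A circuit of size s is a list of s vertices in topological
  -- order; a vertex is a leaf (constant or variable) or a gate (+ or ×)
  -- with exactly two (left, right) children among the earlier vertices,
  -- each incoming edge carrying a field-constant weight.

  data Op : Set where
    plus times : Op

  data Node (m : ℕ) : Set c where
    leafConst : Carrier → Node m
    leafVar   : Var → Node m
    gate      : Op → (left right : Fin m) → (wl wr : Carrier) → Node m

  data Circuit : ℕ → Set c where
    []  : Circuit 0
    _▹_ : ∀ {m} → Circuit m → Node m → Circuit (suc m)

  liftNode : ∀ {m} → Node m → Node (suc m)
  liftNode (leafConst a)         = leafConst a
  liftNode (leafVar v)           = leafVar v
  liftNode (gate o l r wl wr)    = gate o (inject₁ l) (inject₁ r) wl wr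

  -- all vertices, with children indices referring to the whole circuit
  nodes : ∀ {m} → Circuit m → Vec (Node m) m
  nodes []      = Vec.[]
  nodes (C ▹ x) = Vec.map liftNode (nodes C) ∷ʳ liftNode x

  evalNode : ∀ {m} → Vec PolyXY m → Node m → PolyXY
  evalNode vs (leafConst a)            = constₚ a
  evalNode vs (leafVar v)              = monoₚ decVar (v ∷ [])
  evalNode vs (gate plus  l r wl wr)   = (wl ·ₚ lookup vs l) +ₚ (wr ·ₚ lookup vs r)
  evalNode vs (gate times l r wl wr)   = (wl ·ₚ lookup vs l) *ₚ (wr ·ₚ lookup vs r)

  evals : ∀ {m} → Circuit m → Vec PolyXY m
  evals []      = Vec.[]
  evals (C ▹ x) = evals C ∷ʳ evalNode (evals C) x

  degNode : ∀ {m} → Vec ℕ m → Node m → ℕ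
  degNode ds (leafConst _)          = 0
  degNode ds (leafVar _)            = 1
  degNode ds (gate plus  l r _ _)   = lookup ds l ℕ.⊔ lookup ds r
  degNode ds (gate times l r _ _)   = lookup ds l ℕ.+ lookup ds r

  degs : ∀ {m} → Circuit m → Vec ℕ m
  degs []      = Vec.[]
  degs (C ▹ x) = degs C ∷ʳ degNode (degs C) x

  module Construction {s : ℕ} (Ψ : Circuit s) where

    node : Fin s → Node s
    node g = lookup (nodes Ψ) g

    poly : Fin s → PolyXY
    poly g = lookup (evals Ψ) g

    d : Fin s → ℕ
    d g = lookup (degs Ψ) g

    levels : List ℕ
    levels = sort (deduplicate ℕ._≟_ (Vec.toList (degs Ψ)))

    d' : ℕ
    d' = length levels

    nth : List ℕ → ℕ → ℕ
    nth []       _       = 0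
    nth (x ∷ xs) zero    = x
    nth (x ∷ xs) (suc k) = nth xs k

    -- l_k (1-indexed; only used for 1 ≤ k ≤ d')
    l : ℕ → ℕ
    l k = nth levels (k ∸ 1)

    InP : ℕ → Fin s → Set c
    InP k g = (Σ (Fin s) λ a → Σ (Fin s) λ b → Σ Carrier λ wa → Σ Carrier λ wb →
                node g ≡ gate times a b wa wb) × (d g ≡ l k)

    InM : ℕ → PolyX → Set (c ⊔ ℓ)
    InM k p = Σ (Fin s) λ g → Σ (Fin s) λ a → Σ (Fin s) λ b →
              Σ Carrier λ wa → Σ Carrier λ wb →
              (node g ≡ gate times a b wa wb) × (d g ≡ l k) × (p ≈ₚ restrictX (poly a))

    -- membership in 𝓑_k (as a set of polynomials, i.e. up to ≈ₚ)
    InB : ℕ → PolyX → Set (c ⊔ ℓ)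
    InB zero          v = Lift c ((v ≈ₚ 1ₚ) ⊎ (Σ (Fin n) λ i → v ≈ₚ xₚ i))   -- unused (d' ≥ 1)
    InB (suc zero)    v = Lift c ((v ≈ₚ 1ₚ) ⊎ (Σ (Fin n) λ i → v ≈ₚ xₚ i))
    InB (suc (suc k)) v =
        InB (suc k) v
      ⊎ (Σ (Fin s) λ g → InP (suc (suc k)) g × (v ≈ₚ restrictX (poly g)))
      ⊎ (Σ PolyX λ p → Σ PolyX λ h →
           InM (suc (suc k)) p × InB (suc k) h × (v ≈ₚ (p *ₚ h)))

module Submission where

open import Defs
open import Level using (Level; _⊔_; lift)
open import Function using (_∘_; id)
open import Data.Empty using (⊥; ⊥-elim)
open import Data.Product using (Σ; _×_; _,_)
open import Data.Sum using (_⊎_; inj₁; inj₂)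
open import Data.Nat as ℕ
  using (ℕ; zero; suc; _+_; _*_; _^_; _!; _≤_; _<_; z≤n; s≤s; NonZero; _≟_; _≤?_)
import Data.Nat.Properties as ℕ
open import Data.Nat.Solver using (module +-*-Solver)
open import Data.Nat.ListAction using (sum)
open import Data.Integer as ℤ using (+_; +≤+)
import Data.Integer.Properties as ℤ
open import Data.Rational as ℚ using (ℚ; toℚᵘ)
import Data.Rational.Properties as ℚ
open import Data.Rational.Unnormalised as ℚᵘ using (mkℚᵘ; *≤*; *≡*)
import Data.Rational.Unnormalised.Properties as ℚᵘ
open import Data.Fin using (Fin)
open import Data.List
  using (List; []; _∷_; _++_; length; map; allFin; filter; applyDownFrom; cartesianProductWith)
import Data.List.Properties as List
open import Data.List.Relation.Unary.All as All using (All; []; _∷_)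
open import Data.List.Relation.Unary.Any as Any using (Any; here; there; index; _─_)
import Data.List.Relation.Unary.Any.Properties as Any
open import Data.List.Relation.Unary.AllPairs using (AllPairs; []; _∷_)
open import Data.List.Membership.Propositional using (lose)
open import Data.List.Membership.Propositional.Properties using (∈-allFin; ∈-filter⁺)
open import Data.List.Sort ℕ.≤-decTotalOrder using (sort-↭)
open import Data.List.Relation.Unary.Unique.DecPropositional.Properties ℕ._≟_ using (deduplicate-!)
open import Data.List.Relation.Binary.Permutation.Propositional using (↭⇒↭ₛ; ↭-sym)
import Data.List.Relation.Binary.Permutation.Setoid.Properties as Permutation
open import Relation.Binary.Core using (Rel)
open import Relation.Binary.Definitions using (Symmetric; Transitive)
open import Relation.Binary.PropositionalEquality
  using (_≡_; _≢_; refl; sym; trans; cong; cong₂; subst; subst₂; setoid; module ≡-Reasoning)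
open import Relation.Nullary using (¬_; yes; no)
open import Relation.Unary using (Pred; Decidable)

-- Up to ≈, every element of 𝓑_{d'} is a product p₁ ⋯ p_r b with b ∈ {1, x_i, ĝ_X} (at most s+n+1
-- choices) and p_j the X-part of the left child of a gate of syntactic degree l_{k_j}, where
-- k₁ > ⋯ > k_r.  The p_j have no constant term, so such a product has no monomial of degree < r
-- and π_n kills it unless r ≤ n.  For fixed r there are at most (s+n+1) e_r(q₁, …, q_{d'}) such
-- products, q_k being the number of gates of degree l_k, and e_r(q) r! ≤ (Σ q)^r ≤ s^r.  Pairwise
-- distinct elements of 𝓑_{d'} with π_n v ≠ 0 are thus at most Σ_{r ≤ n} (s+n+1) s^r / r!.

elementary : List ℕ → ℕ → ℕ
elementary _        zero    = 1
elementary []       (suc r) = 0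
elementary (p ∷ ps) (suc r) = elementary ps (suc r) + p * elementary ps r

module _ where
  open +-*-Solver
  open ℕ.≤-Reasoning

  binomial-two-terms≤ : ∀ S p r → S ^ suc r + suc r * p * S ^ r ≤ (p + S) ^ suc r
  binomial-two-terms≤ S p zero = ℕ.≤-reflexive
    (solve 2 (λ S p → S :* con 1 :+ con 1 :* p :* con 1 := (p :+ S) :* con 1) refl S p)
  binomial-two-terms≤ S p (suc r) = begin
    S ^ suc (suc r) + suc (suc r) * p * S ^ suc r
      ≤⟨ ℕ.m≤m+n _ _ ⟩
    S ^ suc (suc r) + suc (suc r) * p * S ^ suc r + suc r * p * p * S ^ r
      ≡⟨ solve 4 (λ S p X r → S :* (S :* X) :+ (con 2 :+ r) :* p :* (S :* X) :+ (con 1 :+ r) :* p :* p :* X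
                  := (p :+ S) :* (S :* X :+ (con 1 :+ r) :* p :* X)) refl S p (S ^ r) r ⟩
    (p + S) * (S ^ suc r + suc r * p * S ^ r)
      ≤⟨ ℕ.*-monoʳ-≤ (p + S) (binomial-two-terms≤ S p r) ⟩
    (p + S) ^ suc (suc r) ∎

  -- Each of the r! orderings of the r distinct factors of a term of e_r is one term of (Σ ps)^r.
  elementary*!≤sum^ : ∀ ps r → elementary ps r * r ! ≤ sum ps ^ r
  elementary*!≤sum^ _        zero    = ℕ.≤-refl
  elementary*!≤sum^ []       (suc r) = z≤n
  elementary*!≤sum^ (p ∷ ps) (suc r) = begin
    (E₊ + p * E) * (suc r * r !)
      ≡⟨ solve 5 (λ E₊ p E r F → (E₊ :+ p :* E) :* ((con 1 :+ r) :* F)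
                  := E₊ :* ((con 1 :+ r) :* F) :+ (con 1 :+ r) :* p :* (E :* F)) refl E₊ p E r (r !) ⟩
    E₊ * (suc r * r !) + suc r * p * (E * r !)
      ≤⟨ ℕ.+-mono-≤ (elementary*!≤sum^ ps (suc r)) (ℕ.*-monoʳ-≤ (suc r * p) (elementary*!≤sum^ ps r)) ⟩
    sum ps ^ suc r + suc r * p * sum ps ^ r
      ≤⟨ binomial-two-terms≤ (sum ps) p r ⟩
    (p + sum ps) ^ suc r ∎
    where
    E₊ = elementary ps (suc r)
    E  = elementary ps r

module _ {a p} {A : Set a} {P : ℕ → Pred A p} (P? : ∀ k → Decidable (P k)) where

  private
    hits : ℕ → List A → ℕ
    hits K xs = sum (applyDownFrom (λ k → length (filter (P? k) xs)) K)

    hits-[] : ∀ K → hits K [] ≡ 0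
    hits-[] zero    = refl
    hits-[] (suc K) = hits-[] K

    hits-∷-miss : ∀ K {x xs} → (∀ {k} → k < K → ¬ P k x) → hits K (x ∷ xs) ≡ hits K xs
    hits-∷-miss zero    miss = refl
    hits-∷-miss (suc K) miss = cong₂ _+_
      (cong length (List.filter-reject (P? K) (miss (ℕ.n<1+n K))))
      (hits-∷-miss K (miss ∘ ℕ.m<n⇒m<1+n))

    hits-∷ : ∀ K {x xs} → (∀ {i j} → i < K → j < K → P i x → P j x → i ≡ j) →
             hits K (x ∷ xs) ≤ suc (hits K xs)
    hits-∷ zero    disjoint = z≤n
    hits-∷ (suc K) {x} {xs} disjoint with P? K x
    ... | yes px = ℕ.≤-reflexive (cong (λ h → suc (length (filter (P? K) xs) + h))
          (hits-∷-miss K λ k<K pkx → ℕ.<-irrefl (disjoint (ℕ.m<n⇒m<1+n k<K) (ℕ.n<1+n K) pkx px) k<K))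
    ... | no ¬px = begin
          length (filter (P? K) xs) + hits K (x ∷ xs)
            ≤⟨ ℕ.+-monoʳ-≤ _ (hits-∷ K λ i<K j<K → disjoint (ℕ.m<n⇒m<1+n i<K) (ℕ.m<n⇒m<1+n j<K)) ⟩
          length (filter (P? K) xs) + suc (hits K xs)
            ≡⟨ ℕ.+-suc _ _ ⟩
          suc (hits (suc K) xs) ∎
      where open ℕ.≤-Reasoning

  sum-length-filter≤length : ∀ K xs → (∀ {i j x} → i < K → j < K → P i x → P j x → i ≡ j) →
    sum (applyDownFrom (λ k → length (filter (P? k) xs)) K) ≤ length xs
  sum-length-filter≤length K []       _        = ℕ.≤-reflexive (hits-[] K)
  sum-length-filter≤length K (x ∷ xs) disjoint =
    ℕ.≤-trans (hits-∷ K disjoint) (s≤s (sum-length-filter≤length K xs disjoint))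

length-cartesianProductWith : ∀ {a b c} {A : Set a} {B : Set b} {C : Set c} (f : A → B → C) xs ys →
  length (cartesianProductWith f xs ys) ≡ length xs * length ys
length-cartesianProductWith f []       ys = refl
length-cartesianProductWith f (x ∷ xs) ys = trans (List.length-++ (map (f x) ys))
  (cong₂ _+_ (List.length-map (f x) ys) (length-cartesianProductWith f xs ys))

Any-─⁺ : ∀ {a p q} {A : Set a} {P : Pred A p} {Q : Pred A q} {ys} (p : Any P ys) →
         Any Q ys → (∀ {y} → P y → Q y → ⊥) → Any Q (ys ─ p)
Any-─⁺ (here py) (here qy) disjoint = ⊥-elim (disjoint py qy)
Any-─⁺ (here _)  (there q) _        = q
Any-─⁺ (there p) (here qy) _        = here qy
Any-─⁺ (there p) (there q) disjoint = there (Any-─⁺ p q disjoint)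

module _ {a r} {A : Set a} {R : Rel A r} (R-sym : Symmetric R) (R-trans : Transitive R) where

  distinct-cover⇒length≤ : ∀ {xs ys} → AllPairs (λ u v → ¬ R u v) xs →
                           All (λ x → Any (R x) ys) xs → length xs ≤ length ys
  distinct-cover⇒length≤ [] [] = z≤n
  distinct-cover⇒length≤ {x ∷ xs} {ys} (x≁xs ∷ xs-distinct) (x∈ys ∷ xs∈ys) =
    subst (suc (length xs) ≤_) (sym (List.length-removeAt′ ys (index x∈ys)))
      (s≤s (distinct-cover⇒length≤ xs-distinct (All.zipWith remains (x≁xs , xs∈ys))))
    where
    remains : ∀ {x′} → ¬ R x x′ × Any (R x′) ys → Any (R x′) (ys ─ x∈ys)
    remains (x≁x′ , x′∈ys) = Any-─⁺ x∈ys x′∈ys λ Rxy Rx′y → x≁x′ (R-trans Rxy (R-sym Rx′y))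

-- ℚ._/_ normalises, but fromℚᵘ (mkℚᵘ i m) is by definition i ℚ./ suc m.
toℚᵘ-/ : ∀ k m .{{_ : NonZero m}} → ℚᵘ._≃_ (toℚᵘ ((+ k) ℚ./ m)) ((+ k) ℚᵘ./ m)
toℚᵘ-/ k (suc m) = ℚ.toℚᵘ-fromℚᵘ (mkℚᵘ (+ k) m)

ℕtoℚ-homo-+ : ∀ a b → ℕtoℚ (a + b) ≡ ℕtoℚ a ℚ.+ ℕtoℚ b
ℕtoℚ-homo-+ a b = ℚ.toℚᵘ-injective (begin
  toℚᵘ (ℕtoℚ (a + b))                          ≈⟨ toℚᵘ-/ (a + b) 1 ⟩
  (+ (a + b)) ℚᵘ./ 1                            ≈⟨ *≡* (cong (ℤ._* + 1) integers) ⟩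
  ((+ a) ℚᵘ./ 1) ℚᵘ.+ ((+ b) ℚᵘ./ 1)            ≈⟨ ℚᵘ.+-cong (toℚᵘ-/ a 1) (toℚᵘ-/ b 1) ⟨
  toℚᵘ (ℕtoℚ a) ℚᵘ.+ toℚᵘ (ℕtoℚ b)              ≈⟨ ℚ.toℚᵘ-homo-+ (ℕtoℚ a) (ℕtoℚ b) ⟨
  toℚᵘ (ℕtoℚ a ℚ.+ ℕtoℚ b)                      ∎)
  where
  open import Relation.Binary.Reasoning.Setoid ℚᵘ.≃-setoid
  integers : + (a + b) ≡ + a ℤ.* + 1 ℤ.+ + b ℤ.* + 1
  integers = trans (ℤ.pos-+ a b) (sym (cong₂ ℤ._+_ (ℤ.*-identityʳ (+ a)) (ℤ.*-identityʳ (+ b))))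

ℕtoℚ-homo-* : ∀ a b → ℕtoℚ (a * b) ≡ ℕtoℚ a ℚ.* ℕtoℚ b
ℕtoℚ-homo-* a b = ℚ.toℚᵘ-injective (begin
  toℚᵘ (ℕtoℚ (a * b))                          ≈⟨ toℚᵘ-/ (a * b) 1 ⟩
  (+ (a * b)) ℚᵘ./ 1                            ≈⟨ *≡* (cong (ℤ._* + 1) (ℤ.pos-* a b)) ⟩
  ((+ a) ℚᵘ./ 1) ℚᵘ.* ((+ b) ℚᵘ./ 1)            ≈⟨ ℚᵘ.*-cong (toℚᵘ-/ a 1) (toℚᵘ-/ b 1) ⟨
  toℚᵘ (ℕtoℚ a) ℚᵘ.* toℚᵘ (ℕtoℚ b)              ≈⟨ ℚ.toℚᵘ-homo-* (ℕtoℚ a) (ℕtoℚ b) ⟨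
  toℚᵘ (ℕtoℚ a ℚ.* ℕtoℚ b)                      ∎)
  where open import Relation.Binary.Reasoning.Setoid ℚᵘ.≃-setoid

ℕtoℚ-≤-/ : ∀ a k m .{{_ : NonZero m}} → a * m ≤ k → ℕtoℚ a ℚ.≤ (+ k) ℚ./ m
ℕtoℚ-≤-/ a k m@(suc _) am≤k = ℚ.toℚᵘ-cancel-≤
  (ℚᵘ.≤-respˡ-≃ (ℚᵘ.≃-sym (toℚᵘ-/ a 1)) (ℚᵘ.≤-respʳ-≃ (ℚᵘ.≃-sym (toℚᵘ-/ k m))
    (*≤* (subst₂ ℤ._≤_ (ℤ.pos-* a m) (sym (ℤ.*-identityʳ (+ k))) (+≤+ am≤k)))))

ℕtoℚ-mono-≤ : ∀ {a b} → a ≤ b → ℕtoℚ a ℚ.≤ ℕtoℚ b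
ℕtoℚ-mono-≤ {a} {b} a≤b = ℕtoℚ-≤-/ a b 1 (subst (_≤ b) (sym (ℕ.*-identityʳ a)) a≤b)

sumUpTo-mono-≤ : ∀ n {f g : ℕ → ℚ} → (∀ r → f r ℚ.≤ g r) → sumUpTo n f ℚ.≤ sumUpTo n g
sumUpTo-mono-≤ zero    f≤g = f≤g 0
sumUpTo-mono-≤ (suc n) f≤g = ℚ.+-mono-≤ (sumUpTo-mono-≤ n f≤g) (f≤g (suc n))

*-distribˡ-sumUpTo : ∀ q n (f : ℕ → ℚ) → q ℚ.* sumUpTo n f ≡ sumUpTo n (λ r → q ℚ.* f r)
*-distribˡ-sumUpTo q zero    f = refl
*-distribˡ-sumUpTo q (suc n) f = trans (ℚ.*-distribˡ-+ q (sumUpTo n f) (f (suc n)))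
                                       (cong (ℚ._+ q ℚ.* f (suc n)) (*-distribˡ-sumUpTo q n f))

expSeriesTerm : ℕ → ℕ → ℚ
expSeriesTerm s r = ((+ (s ^ r)) ℚ./ (r !)) {{r ℕ.!≢0}}

sumUpTo-ℕtoℚ-bound : ∀ B s n (N : ℕ → ℕ) → (∀ r → N r * r ! ≤ s ^ r) →
  sumUpTo n (λ r → ℕtoℚ (B * N r)) ℚ.≤ ℕtoℚ B ℚ.* sumUpTo n (expSeriesTerm s)
sumUpTo-ℕtoℚ-bound B s n N bound = begin
  sumUpTo n (λ r → ℕtoℚ (B * N r))                      ≤⟨ sumUpTo-mono-≤ n termwise ⟩
  sumUpTo n (λ r → ℕtoℚ B ℚ.* expSeriesTerm s r)       ≡⟨ *-distribˡ-sumUpTo (ℕtoℚ B) n _ ⟨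
  ℕtoℚ B ℚ.* sumUpTo n (expSeriesTerm s)                ∎
  where
  open ℚ.≤-Reasoning
  termwise : ∀ r → ℕtoℚ (B * N r) ℚ.≤ ℕtoℚ B ℚ.* expSeriesTerm s r
  termwise r = subst (ℚ._≤ _) (sym (ℕtoℚ-homo-* B (N r)))
    (ℚ.*-monoˡ-≤-nonNeg (ℕtoℚ B) {{ℚ.normalize-nonNeg B 1}}
      (ℕtoℚ-≤-/ (N r) (s ^ r) (r !) {{r ℕ.!≢0}} (bound r)))

module Polynomials {c ℓ : Level} (F : Field c ℓ) (n : ℕ) where
  open Field F using (_≈_; 0#; +-cong; *-cong; zeroˡ; zeroʳ; +-identityˡ)
    renaming (refl to ≈-refl; sym to ≈-sym; trans to ≈-trans)
  open Circuits F n

  ≈ₚ-sym : ∀ {A} {f g : Poly A} → f ≈ₚ g → g ≈ₚ f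
  ≈ₚ-sym f≈g w = ≈-sym (f≈g w)

  ≈ₚ-trans : ∀ {A} {f g h : Poly A} → f ≈ₚ g → g ≈ₚ h → f ≈ₚ h
  ≈ₚ-trans f≈g g≈h w = ≈-trans (f≈g w) (g≈h w)

  *ₚ-cong : ∀ {A} {f f′ g g′ : Poly A} → f ≈ₚ f′ → g ≈ₚ g′ → (f *ₚ g) ≈ₚ (f′ *ₚ g′)
  *ₚ-cong f≈f′ g≈g′ []      = *-cong (f≈f′ []) (g≈g′ [])
  *ₚ-cong f≈f′ g≈g′ (a ∷ w) = +-cong (*-cong (f≈f′ []) (g≈g′ (a ∷ w))) (*ₚ-cong (f≈f′ ∘ (a ∷_)) g≈g′ w)

  VanishesBelow : ∀ {A} → ℕ → Poly A → Set ℓ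
  VanishesBelow r f = ∀ w → length w < r → f w ≈ 0#

  vanishesBelow-resp : ∀ {A r} {f g : Poly A} → f ≈ₚ g → VanishesBelow r g → VanishesBelow r f
  vanishesBelow-resp f≈g g-vanishes w w<r = ≈-trans (f≈g w) (g-vanishes w w<r)

  *ₚ-vanishesBelowʳ : ∀ {A r} (f : Poly A) {g : Poly A} → VanishesBelow r g → VanishesBelow r (f *ₚ g)
  *ₚ-vanishesBelowʳ f g-vanishes []      w<r = ≈-trans (*-cong ≈-refl (g-vanishes [] w<r)) (zeroʳ _)
  *ₚ-vanishesBelowʳ f g-vanishes (a ∷ w) w<r = ≈-trans
    (+-cong (≈-trans (*-cong ≈-refl (g-vanishes (a ∷ w) w<r)) (zeroʳ _))
            (*ₚ-vanishesBelowʳ (f ∘ (a ∷_)) g-vanishes w (ℕ.<-trans (ℕ.n<1+n _) w<r)))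
    (+-identityˡ 0#)

  *ₚ-vanishesBelow-suc : ∀ {A r} {f g : Poly A} → f [] ≈ 0# → VanishesBelow r g → VanishesBelow (suc r) (f *ₚ g)
  *ₚ-vanishesBelow-suc f[]≈0 g-vanishes []      _         = ≈-trans (*-cong f[]≈0 ≈-refl) (zeroˡ _)
  *ₚ-vanishesBelow-suc f[]≈0 g-vanishes (a ∷ w) (s≤s w<r) = ≈-trans
    (+-cong (≈-trans (*-cong f[]≈0 ≈-refl) (zeroˡ _)) (*ₚ-vanishesBelowʳ _ g-vanishes w w<r))
    (+-identityˡ 0#)

  vanishesBelow⇒πₙ≈0 : ∀ {r} {f : PolyX} → n < r → VanishesBelow r f → πₙ f ≈ₚ 0ₚ
  vanishesBelow⇒πₙ≈0 {r} {f} n<r f-vanishes w with length w ≟ n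
  ... | yes |w|≡n = f-vanishes w (subst (_< r) (sym |w|≡n) n<r)
  ... | no  _     = ≈-refl

module Candidates {c ℓ : Level} (F : Field c ℓ) (n : ℕ) {s : ℕ} (Ψ : Circuits.Circuit F n s) where
  open Circuits F n
  open Construction Ψ
  open Polynomials F n

  All-nth : ∀ {p} {P : Pred ℕ p} {xs} → All P xs → ∀ {i} → i < length xs → P (nth xs i)
  All-nth (px ∷ _)  {zero}  _        = px
  All-nth (_ ∷ pxs) {suc i} (s≤s i<) = All-nth pxs i<

  nth-injective : ∀ {xs} → AllPairs _≢_ xs → ∀ {i j} → i < length xs → j < length xs →
                  nth xs i ≡ nth xs j → i ≡ j
  nth-injective _              {zero}  {zero}  _        _        _  = refl
  nth-injective (x∉xs ∷ _)     {zero}  {suc j} _        (s≤s j<) eq = ⊥-elim (All-nth x∉xs j< eq)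
  nth-injective (x∉xs ∷ _)     {suc i} {zero}  (s≤s i<) _        eq = ⊥-elim (All-nth x∉xs i< (sym eq))
  nth-injective (_ ∷ distinct) {suc i} {suc j} (s≤s i<) (s≤s j<) eq = cong suc (nth-injective distinct i< j< eq)

  levels-distinct : AllPairs _≢_ levels
  levels-distinct = Permutation.Unique-resp-↭ (setoid ℕ) (↭⇒↭ₛ (↭-sym (sort-↭ _))) (deduplicate-! _)

  -- level k is the paper's l_{k+1}
  level : ℕ → ℕ
  level k = nth levels k

  gatesAt : ℕ → List (Fin s)
  gatesAt k = filter (λ g → d g ≟ level k) (allFin s)

  gateLists : ℕ → List (List (Fin s))
  gateLists = applyDownFrom gatesAt

  sum-length-gateLists≤ : sum (map length (gateLists d')) ≤ s
  sum-length-gateLists≤ = begin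
    sum (map length (gateLists d'))            ≡⟨ cong sum (List.map-applyDownFrom gatesAt length d') ⟩
    sum (applyDownFrom (length ∘ gatesAt) d')  ≤⟨ sum-length-filter≤length (λ k g → d g ≟ level k) d' (allFin s) disjoint ⟩
    length (allFin s)                          ≡⟨ List.length-tabulate _ ⟩
    s                                          ∎
    where
    open ℕ.≤-Reasoning
    disjoint : ∀ {i j g} → i < d' → j < d' → d g ≡ level i → d g ≡ level j → i ≡ j
    disjoint i<d' j<d' dg≡i dg≡j = nth-injective levels-distinct i<d' j<d' (trans (sym dg≡i) dg≡j)

  -- Only the value at × gates matters; the other vertices merely add superfluous candidates.
  leftFactorOf : Node s → PolyX
  leftFactorOf (gate _ a _ _ _) = restrictX (poly a)
  leftFactorOf (leafConst _)    = 0ₚ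
  leftFactorOf (leafVar _)      = 0ₚ

  leftFactor : Fin s → PolyX
  leftFactor g = leftFactorOf (node g)

  base : List PolyX
  base = 1ₚ ∷ map xₚ (allFin n) ++ map (restrictX ∘ poly) (allFin s)

  length-base : length base ≡ s + n + 1
  length-base = trans (cong suc (begin
    length (map xₚ (allFin n) ++ map (restrictX ∘ poly) (allFin s))  ≡⟨ List.length-++ (map xₚ (allFin n)) ⟩
    length (map xₚ (allFin n)) + length (map (restrictX ∘ poly) (allFin s))
      ≡⟨ cong₂ _+_ (trans (List.length-map xₚ (allFin n)) (List.length-tabulate {n = n} id))
                   (trans (List.length-map (restrictX ∘ poly) (allFin s)) (List.length-tabulate {n = s} id)) ⟩
    n + s                                                            ≡⟨ ℕ.+-comm n s ⟩
    s + n                                                            ∎))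
    (sym (ℕ.+-comm (s + n) 1))
    where open ≡-Reasoning

  -- The products leftFactor g₁ ⋯ leftFactor g_r b with b ∈ base and g₁, …, g_r taken from r
  -- distinct lists of gss, in order.
  candidates : List (List (Fin s)) → ℕ → List PolyX
  candidates _          zero    = base
  candidates []         (suc r) = []
  candidates (gs ∷ gss) (suc r) =
    candidates gss (suc r) ++ cartesianProductWith (λ g h → leftFactor g *ₚ h) gs (candidates gss r)

  length-candidates : ∀ gss r → length (candidates gss r) ≡ length base * elementary (map length gss) r
  length-candidates _          zero    = sym (ℕ.*-identityʳ _)
  length-candidates []         (suc r) = sym (ℕ.*-zeroʳ (length base))
  length-candidates (gs ∷ gss) (suc r) = begin
    length (candidates gss (suc r) ++ cartesianProductWith _ gs (candidates gss r))
      ≡⟨ List.length-++ (candidates gss (suc r)) ⟩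
    length (candidates gss (suc r)) + length (cartesianProductWith _ gs (candidates gss r))
      ≡⟨ cong₂ _+_ (length-candidates gss (suc r))
                   (trans (length-cartesianProductWith _ gs _) (cong (length gs *_) (length-candidates gss r))) ⟩
    B * E₊ + length gs * (B * E)
      ≡⟨ solve 4 (λ B E₊ p E → B :* E₊ :+ p :* (B :* E) := B :* (E₊ :+ p :* E)) refl B E₊ (length gs) E ⟩
    B * (E₊ + length gs * E) ∎
    where
    open ≡-Reasoning
    open +-*-Solver
    B  = length base
    E₊ = elementary (map length gss) (suc r)
    E  = elementary (map length gss) r

  candidates-∷⁺ : ∀ {v} gs gss r → Any (v ≈ₚ_) (candidates gss r) → Any (v ≈ₚ_) (candidates (gs ∷ gss) r)
  candidates-∷⁺ gs gss zero    v∈ = v∈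
  candidates-∷⁺ gs gss (suc r) v∈ = Any.++⁺ˡ v∈

  Candidate : List (List (Fin s)) → PolyX → Set (c ⊔ ℓ)
  Candidate gss v = Σ ℕ λ r → Any (v ≈ₚ_) (candidates gss r) × VanishesBelow r v

  base-candidate : ∀ {gss v} → Any (v ≈ₚ_) base → Candidate gss v
  base-candidate v∈ = 0 , v∈ , λ _ ()

  𝓑₁⊆base : ∀ {v} → (v ≈ₚ 1ₚ) ⊎ (Σ (Fin n) λ i → v ≈ₚ xₚ i) → Any (v ≈ₚ_) base
  𝓑₁⊆base (inj₁ v≈1)          = here v≈1
  𝓑₁⊆base (inj₂ (i , v≈xᵢ)) = there (Any.++⁺ˡ (Any.map⁺ (lose (∈-allFin i) v≈xᵢ)))

  InB⇒Candidate : ∀ k {v} → InB k v → Candidate (gateLists k) v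
  InB⇒Candidate zero          (lift v∈𝓑₁) = base-candidate (𝓑₁⊆base v∈𝓑₁)
  InB⇒Candidate (suc zero)    (lift v∈𝓑₁) = base-candidate (𝓑₁⊆base v∈𝓑₁)
  InB⇒Candidate (suc (suc k)) (inj₁ v∈𝓑) with InB⇒Candidate (suc k) v∈𝓑
  ... | r , v∈ , v-vanishes = r , candidates-∷⁺ _ _ r v∈ , v-vanishes
  InB⇒Candidate (suc (suc k)) (inj₂ (inj₁ (g , _ , v≈ĝ))) =
    base-candidate (there (Any.++⁺ʳ _ (Any.map⁺ (lose (∈-allFin g) v≈ĝ))))
  InB⇒Candidate (suc (suc k)) {v} (inj₂ (inj₂ (p , h , (g , _ , _ , _ , _ , g≡a×b , dg , p≈â) , h∈𝓑 , v≈ph)))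
    with InB⇒Candidate (suc k) h∈𝓑
  ... | r , h∈ , h-vanishes =
    suc r ,
    Any.++⁺ʳ _ (Any.cartesianProductWith⁺ _ extend (∈-filter⁺ _ (∈-allFin g) dg) h∈) ,
    vanishesBelow-resp v≈ph (*ₚ-vanishesBelow-suc (p≈â []) h-vanishes)
    where
    extend : ∀ {g′ h′} → g ≡ g′ → h ≈ₚ h′ → v ≈ₚ (leftFactor g′ *ₚ h′)
    extend refl h≈h′ =
      ≈ₚ-trans v≈ph (*ₚ-cong (subst (p ≈ₚ_) (sym (cong leftFactorOf g≡a×b)) p≈â) h≈h′)

  candidatesUpTo : List (List (Fin s)) → ℕ → List PolyX
  candidatesUpTo gss zero    = candidates gss zero
  candidatesUpTo gss (suc m) = candidatesUpTo gss m ++ candidates gss (suc m)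

  candidatesUpTo⁺ : ∀ {p} {P : Pred PolyX p} gss {r} m → r ≤ m →
                    Any P (candidates gss r) → Any P (candidatesUpTo gss m)
  candidatesUpTo⁺ gss zero z≤n v∈ = v∈
  candidatesUpTo⁺ gss {r} (suc m) r≤1+m v∈ with r ≟ suc m
  ... | yes refl = Any.++⁺ʳ _ v∈
  ... | no  r≢1+m = Any.++⁺ˡ (candidatesUpTo⁺ gss m (ℕ.≤-pred (ℕ.≤∧≢⇒< r≤1+m r≢1+m)) v∈)

  ℕtoℚ-length-candidatesUpTo : ∀ gss m → ℕtoℚ (length (candidatesUpTo gss m)) ≡
    sumUpTo m (λ r → ℕtoℚ (length base * elementary (map length gss) r))
  ℕtoℚ-length-candidatesUpTo gss zero    = cong ℕtoℚ (length-candidates gss 0)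
  ℕtoℚ-length-candidatesUpTo gss (suc m) = begin
    ℕtoℚ (length (candidatesUpTo gss m ++ candidates gss (suc m)))
      ≡⟨ cong ℕtoℚ (List.length-++ (candidatesUpTo gss m)) ⟩
    ℕtoℚ (length (candidatesUpTo gss m) + length (candidates gss (suc m)))
      ≡⟨ ℕtoℚ-homo-+ (length (candidatesUpTo gss m)) (length (candidates gss (suc m))) ⟩
    ℕtoℚ (length (candidatesUpTo gss m)) ℚ.+ ℕtoℚ (length (candidates gss (suc m)))
      ≡⟨ cong₂ ℚ._+_ (ℕtoℚ-length-candidatesUpTo gss m) (cong ℕtoℚ (length-candidates gss (suc m))) ⟩
    sumUpTo (suc m) (λ r → ℕtoℚ (length base * elementary (map length gss) r)) ∎
    where open ≡-Reasoning

  nonvanishing-𝓑⇒candidateUpTo : ∀ {v} → InB d' v × ¬ (πₙ v ≈ₚ 0ₚ) →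
                                 Any (v ≈ₚ_) (candidatesUpTo (gateLists d') n)
  nonvanishing-𝓑⇒candidateUpTo (v∈𝓑 , πₙv≉0) with InB⇒Candidate d' v∈𝓑
  ... | r , v∈ , v-vanishes with r ≤? n
  ...   | yes r≤n = candidatesUpTo⁺ _ n r≤n v∈
  ...   | no  r≰n = ⊥-elim (πₙv≉0 (vanishesBelow⇒πₙ≈0 (ℕ.≰⇒> r≰n) v-vanishes))

theorem11 : ∀ {c ℓ : Level} (F : Field c ℓ) (n s : ℕ) (Ψ : Circuits.Circuit F n s) →
    Σ (Fin s) (λ g → Circuits._≈ₚ_ F n (Circuits.Construction.poly F n Ψ g) (Circuits.Pal F n)) →
    (L : List (Circuits.PolyX F n)) →
    All (λ v → Circuits.Construction.InB F n Ψ (Circuits.Construction.d' F n Ψ) v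
               × ¬ Circuits._≈ₚ_ F n (Circuits.πₙ F n v) (Circuits.0ₚ F n)) L →
    AllPairs (λ u v → ¬ Circuits._≈ₚ_ F n u v) L →
    ℕtoℚ (length L) ℚ.≤ palBound s n
theorem11 F n s Ψ _ L L⊆𝓑 L-distinct = begin
  ℕtoℚ (length L)
    ≤⟨ ℕtoℚ-mono-≤ (distinct-cover⇒length≤ ≈ₚ-sym ≈ₚ-trans L-distinct
                      (All.map nonvanishing-𝓑⇒candidateUpTo L⊆𝓑)) ⟩
  ℕtoℚ (length (candidatesUpTo gss n))
    ≡⟨ ℕtoℚ-length-candidatesUpTo gss n ⟩
  sumUpTo n (λ r → ℕtoℚ (length base * elementary (map length gss) r))
    ≤⟨ sumUpTo-ℕtoℚ-bound (length base) s n (elementary (map length gss)) elementary-bound ⟩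
  ℕtoℚ (length base) ℚ.* sumUpTo n (expSeriesTerm s)
    ≡⟨ cong (λ B → ℕtoℚ B ℚ.* sumUpTo n (expSeriesTerm s)) length-base ⟩
  palBound s n ∎
  where
  open ℚ.≤-Reasoning
  open Circuits F n
  open Construction Ψ using (d')
  open Polynomials F n
  open Candidates F n Ψ
  gss : List (List (Fin s))
  gss = gateLists d'
  elementary-bound : ∀ r → elementary (map length gss) r * r ! ≤ s ^ r
  elementary-bound r =
    ℕ.≤-trans (elementary*!≤sum^ (map length gss) r) (ℕ.^-monoˡ-≤ r sum-length-gateLists≤)
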